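{- Let $m$ and $k$ be positive integers such that $2m-1<R(m-k,3)$ and $m\ge k+3$. Then $F_v(2_r;r-k+1)\le r+m$ for every integer $r\ge m-1$.
   Context: All graphs are finite, simple and undirected; $\omega(G)$ is the clique number and $\alpha(G)$ the independence number. $R(p,3)$ is the smallest $n$ such that every graph on at least $n$ vertices has $\omega(G)\ge p$ or $\alpha(G)\ge 3$. $G\overset{v}{\to}(2_r)$ means that for every partition of $V(G)$ into $r$ pairwise disjoint (possibly empty) sets, some part contains two adjacent vertices (equivalently, $\chi(G)\ge r+1$). $F_v(2_r;q)$ is the minimum of $|V(G)|$ over all graphs $G$ with $G\overset{v}{\to}(2_r)$ and $\omega(G)<q$ (it exists iff $q\ge 3$). -}

module Defs where

open import Data.Nat using (ℕ; _≤_; _<_)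
open import Data.Fin using (Fin)
open import Data.Bool using (Bool; true)
open import Data.Product using (Σ; _×_; ∃-syntax)
open import Relation.Binary.PropositionalEquality using (_≡_; _≢_)
open import Relation.Nullary using (¬_)
open import Function.Definitions using (Injective)

record Graph (n : ℕ) : Set where
  field
    adj     : Fin n → Fin n → Bool
    sym     : ∀ u v → adj u v ≡ adj v u
    irrefl  : ∀ v → adj v v ≢ true

open Graph public

Adj : ∀ {n} → Graph n → Fin n → Fin n → Set
Adj G u v = adj G u v ≡ true

HasClique : ∀ {n} → Graph n → ℕ → Set
HasClique {n} G p = Σ (Fin p → Fin n) λ f →
  Injective _≡_ _≡_ f × (∀ i j → i ≢ j → Adj G (f i) (f j))

HasIndep : ∀ {n} → Graph n → ℕ → Set
HasIndep {n} G p = Σ (Fin p → Fin n) λ f →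
  Injective _≡_ _≡_ f × (∀ i j → i ≢ j → ¬ Adj G (f i) (f j))

IsLeast : (ℕ → Set) → ℕ → Set
IsLeast P N = P N × (∀ M → P M → N ≤ M)

RamseyProp : ℕ → ℕ → Set
RamseyProp p n = ∀ N → n ≤ N → (G : Graph N) → HasClique G p Data.Sum.⊎ HasIndep G 3
  where import Data.Sum

IsRamsey3 : ℕ → ℕ → Set
IsRamsey3 p R = IsLeast (RamseyProp p) R

-- G →v (2_r): every partition of V(G) into r (possibly empty) parts
-- has a part containing two adjacent vertices.
VArrow2 : ∀ {n} → Graph n → ℕ → Set
VArrow2 {n} G r = (c : Fin n → Fin r) → ∃[ u ] ∃[ v ] (Adj G u v × c u ≡ c v)

FvWitness : ℕ → ℕ → ℕ → Set
FvWitness r q N = Σ (Graph N) λ G → VArrow2 G r × ¬ HasClique G q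

IsFv : ℕ → ℕ → ℕ → Set
IsFv r q F = IsLeast (FvWitness r q) F

-- Since 2m − 1 < R(m − k, 3), some graph H on 2m − 1 vertices has ω(H) < m − k and α(H) < 3.
-- Each colour class of H is independent, hence has at most two vertices, so H →v (2_{m−1}).
-- Adding a vertex adjacent to all others raises both the number of colours forced and the
-- clique number by one, so adding r − m + 1 of them yields a graph on r + m vertices with
-- G →v (2_r) and ω(G) < r − k + 1.  Every property involved is decidable by exhaustive
-- search, so this witness bounds a least one.
module Submission where

open import Defs hiding (sym; irrefl)
open import Data.Nat using (ℕ; zero; suc; _+_; _*_; _∸_; _≤_; _<_; z<s)
import Data.Nat.Properties as ℕ
open import Data.Fin using (Fin; zero; suc; punchIn; punchOut; inject≤; combine)
  renaming (_<_ to _<ᶠ_; _<?_ to _<ᶠ?_)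
open import Data.Fin.Properties
  using (_≟_; any?; all?; pigeonhole; combine-injective; punchIn-injective; punchInᵢ≢i;
         punchIn-punchOut; punchOut-injective; inject≤-injective)
  renaming (<⇒≢ to <ᶠ⇒≢; <-trans to <ᶠ-trans)
open import Data.Bool using (Bool; true; false)
import Data.Bool.Properties as Bool
open import Data.Vec using (Vec; []; _∷_; lookup; tabulate)
open import Data.Vec.Properties using (lookup∘tabulate)
open import Data.Product using (Σ; _×_; _,_; proj₁; proj₂; ∃)
open import Data.Sum using (_⊎_; inj₁; inj₂; [_,_])
open import Data.Empty using (⊥-elim)
open import Function using (_∘_; id)
open import Function.Definitions using (Injective)
open import Level using (0ℓ)
open import Relation.Nullary using (¬_; Dec; yes; no; ¬?)
open import Relation.Nullary.Decidable
  using (map′; decidable-stable; _×-dec_; _⊎-dec_; _→-dec_)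
open import Relation.Unary using (Pred; Decidable)
open import Relation.Binary using (Rel; Symmetric)
open import Relation.Binary.PropositionalEquality
  using (_≡_; _≢_; _≗_; refl; sym; trans; cong; cong₂; subst; subst₂; module ≡-Reasoning)

-- Exhaustive search

Searchable : Set → Set₁
Searchable A = {P : Pred A 0ℓ} → Decidable P → Dec (∃ P)

Bool-searchable : Searchable Bool
Bool-searchable P? = map′ (λ { (inj₁ p) → false , p ; (inj₂ p) → true , p })
                          (λ { (false , p) → inj₁ p ; (true , p) → inj₂ p })
                          (P? false ⊎-dec P? true)

Fin-searchable : ∀ {n} → Searchable (Fin n)
Fin-searchable = any?

Vec-searchable : ∀ {A} → Searchable A → ∀ {n} → Searchable (Vec A n)
Vec-searchable S {zero}  P? = map′ ([] ,_) (λ { ([] , p) → p }) (P? [])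
Vec-searchable S {suc n} P? =
  map′ (λ { (x , xs , p) → x ∷ xs , p }) (λ { (x ∷ xs , p) → x , xs , p })
       (S λ x → Vec-searchable S λ xs → P? (x ∷ xs))

-- A function on Fin n is found through its table of values, hence the respect hypothesis.
∃-fun? : ∀ {A n} → Searchable A → {P : Pred (Fin n → A) 0ℓ} →
         (∀ {f g} → f ≗ g → P f → P g) → Decidable P → Dec (∃ P)
∃-fun? S resp P? =
  map′ (λ { (v , p) → lookup v , p })
       (λ { (f , p) → tabulate f , resp (λ i → sym (lookup∘tabulate f i)) p })
       (Vec-searchable S (P? ∘ lookup))

∀-fun? : ∀ {A n} → Searchable A → {P : Pred (Fin n → A) 0ℓ} →
         (∀ {f g} → f ≗ g → P f → P g) → Decidable P → Dec (∀ f → P f)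
∀-fun? S resp P? =
  map′ (λ ∄¬P f → decidable-stable (P? f) (λ ¬p → ∄¬P (f , ¬p)))
       (λ ∀P (f , ¬p) → ¬p (∀P f))
       (¬? (∃-fun? S (λ f≗g ¬pf pg → ¬pf (resp (sym ∘ f≗g) pg)) (¬? ∘ P?)))

least-or-none : {P : Pred ℕ 0ℓ} → Decidable P → ∀ N →
                (∃ λ n → P n × ∀ M → M < n → ¬ P M) ⊎ (∀ M → M ≤ N → ¬ P M)
least-or-none P? zero with P? zero
... | yes p  = inj₁ (zero , p , λ _ ())
... | no ¬p  = inj₂ λ { zero _ → ¬p }
least-or-none P? (suc N) with least-or-none P? N | P? (suc N)
... | inj₁ found | _     = inj₁ found
... | inj₂ none  | yes p = inj₁ (suc N , p , λ M M<1+N → none M (ℕ.m<1+n⇒m≤n M<1+N))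
... | inj₂ none  | no ¬p = inj₂ λ M M≤1+N →
  [ (λ M<1+N → none M (ℕ.m<1+n⇒m≤n M<1+N)) , (λ { refl → ¬p }) ] (ℕ.m≤n⇒m<n∨m≡n M≤1+N)

least : {P : Pred ℕ 0ℓ} → Decidable P → ∀ {N} → P N → ∃ (IsLeast P)
least P? {N} pN with least-or-none P? N
... | inj₁ (n , pn , below) = n , pn , λ M pM → ℕ.≮⇒≥ (λ M<n → below M M<n pM)
... | inj₂ none             = ⊥-elim (none N ℕ.≤-refl pN)

-- HasClique G p and HasIndep G p unfold to Clique (Adj G) p and Clique (λ u v → ¬ Adj G u v) p.
Clique : ∀ {A : Set} → Rel A 0ℓ → ℕ → Set
Clique {A} R p = Σ (Fin p → A) λ f → Injective _≡_ _≡_ f × (∀ i j → i ≢ j → R (f i) (f j))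

Clique-map : ∀ {A B : Set} {R : Rel A 0ℓ} {S : Rel B 0ℓ} {p} (h : A → B) →
             Injective _≡_ _≡_ h → (∀ u v → R u v → S (h u) (h v)) → Clique R p → Clique S p
Clique-map h h-inj hom (f , f-inj , rel) =
  h ∘ f , f-inj ∘ h-inj , λ i j i≢j → hom (f i) (f j) (rel i j i≢j)

Clique-fromPairwise : ∀ {A : Set} {R : Rel A 0ℓ} {p} → (∀ {x} → ¬ R x x) →
                      (f : Fin p → A) → (∀ i j → i ≢ j → R (f i) (f j)) → Clique R p
Clique-fromPairwise {R = R} irrefl f rel = f , injective , rel
  where
  injective : Injective _≡_ _≡_ f
  injective {x} {y} fx≡fy with x ≟ y
  ... | yes x≡y = x≡y
  ... | no  x≢y = ⊥-elim (irrefl (subst (R (f x)) (sym fx≡fy) (rel x y x≢y)))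

Clique-triple : ∀ {A : Set} {R : Rel A 0ℓ} → (∀ {x} → ¬ R x x) → Symmetric R →
                ∀ {a b c} → R a b → R a c → R b c → Clique R 3
Clique-triple {A} {R} irrefl symm {a} {b} {c} ab ac bc =
  Clique-fromPairwise {R = R} irrefl f rel
  where
  f : Fin 3 → A
  f zero             = a
  f (suc zero)       = b
  f (suc (suc zero)) = c

  rel : ∀ i j → i ≢ j → R (f i) (f j)
  rel zero             zero             i≢i = ⊥-elim (i≢i refl)
  rel zero             (suc zero)       _   = ab
  rel zero             (suc (suc zero)) _   = ac
  rel (suc zero)       zero             _   = symm ab
  rel (suc zero)       (suc zero)       i≢i = ⊥-elim (i≢i refl)
  rel (suc zero)       (suc (suc zero)) _   = bc
  rel (suc (suc zero)) zero             _   = symm ac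
  rel (suc (suc zero)) (suc zero)       _   = symm bc
  rel (suc (suc zero)) (suc (suc zero)) i≢i = ⊥-elim (i≢i refl)

injective? : ∀ {p n} (f : Fin p → Fin n) → Dec (Injective _≡_ _≡_ f)
injective? f = map′ (λ inj {x} {y} → inj x y) (λ inj x y → inj)
                    (all? λ x → all? λ y → (f x ≟ f y) →-dec (x ≟ y))

Clique? : ∀ {n} {R : Rel (Fin n) 0ℓ} → (∀ u v → Dec (R u v)) → ∀ p → Dec (Clique R p)
Clique? {n} {R} R? p =
  ∃-fun? Fin-searchable resp
         (λ f → injective? f ×-dec (all? λ i → all? λ j → ¬? (i ≟ j) →-dec R? (f i) (f j)))
  where
  IsClique : Pred (Fin p → Fin n) 0ℓ
  IsClique f = Injective _≡_ _≡_ f × (∀ i j → i ≢ j → R (f i) (f j))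

  resp : ∀ {f g} → f ≗ g → IsClique f → IsClique g
  resp f≗g (inj , rel) =
    (λ {x} {y} gx≡gy → inj (trans (f≗g x) (trans gx≡gy (sym (f≗g y))))) ,
    (λ i j i≢j → subst₂ R (f≗g i) (f≗g j) (rel i j i≢j))

record _≈ᴳ_ {n} (G H : Graph n) : Set where
  constructor same-adj
  field adj-≡ : ∀ u v → adj G u v ≡ adj H u v

open _≈ᴳ_

≈ᴳ-sym : ∀ {n} {G H : Graph n} → G ≈ᴳ H → H ≈ᴳ G
≈ᴳ-sym G≈H = same-adj λ u v → sym (adj-≡ G≈H u v)

-- Graphs are found through adjacency matrices, which recover a graph only up to ≈ᴳ.
Graph-search : ∀ {n} {Q : Pred (Graph n) 0ℓ} →
               (∀ {G H} → G ≈ᴳ H → Q G → Q H) → Decidable Q → Dec (∃ Q)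
Graph-search {n} {Q} resp Q? =
  map′ (λ { (M , s , i , q) → fromMatrix M s i , q })
       (λ { (G , q) → matrix G , matrix-sym G , matrix-irrefl G ,
                       resp (same-adj λ u v → sym (entry-matrix G u v)) q })
       (Vec-searchable (Vec-searchable Bool-searchable) P?)
  where
  entry : Vec (Vec Bool n) n → Fin n → Fin n → Bool
  entry M u v = lookup (lookup M u) v

  fromMatrix : ∀ M → (∀ u v → entry M u v ≡ entry M v u) → (∀ v → entry M v v ≢ true) →
               Graph n
  fromMatrix M s i = record { adj = entry M ; sym = s ; irrefl = i }

  P : Pred (Vec (Vec Bool n) n) 0ℓ
  P M = Σ (∀ u v → entry M u v ≡ entry M v u) λ s →
        Σ (∀ v → entry M v v ≢ true) λ i → Q (fromMatrix M s i)

  P? : Decidable P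
  P? M with all? (λ u → all? λ v → entry M u v Bool.≟ entry M v u)
          | all? (λ v → ¬? (entry M v v Bool.≟ true))
  ... | no ¬s | _     = no (¬s ∘ proj₁)
  ... | yes _ | no ¬i = no (¬i ∘ proj₁ ∘ proj₂)
  ... | yes s | yes i = map′ (λ q → s , i , q)
                             (λ { (_ , _ , q) → resp (same-adj λ _ _ → refl) q })
                             (Q? (fromMatrix M s i))

  matrix : Graph n → Vec (Vec Bool n) n
  matrix G = tabulate (tabulate ∘ adj G)

  entry-matrix : ∀ G u v → entry (matrix G) u v ≡ adj G u v
  entry-matrix G u v =
    trans (cong (λ row → lookup row v) (lookup∘tabulate (tabulate ∘ adj G) u))
          (lookup∘tabulate (adj G u) v)

  matrix-sym : ∀ G u v → entry (matrix G) u v ≡ entry (matrix G) v u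
  matrix-sym G u v =
    trans (entry-matrix G u v) (trans (Graph.sym G u v) (sym (entry-matrix G v u)))

  matrix-irrefl : ∀ G v → entry (matrix G) v v ≢ true
  matrix-irrefl G v e = Graph.irrefl G v (trans (sym (entry-matrix G v v)) e)

Adj? : ∀ {n} (G : Graph n) u v → Dec (Adj G u v)
Adj? G u v = adj G u v Bool.≟ true

HasClique? : ∀ {n} (G : Graph n) p → Dec (HasClique G p)
HasClique? G = Clique? (Adj? G)

HasIndep? : ∀ {n} (G : Graph n) p → Dec (HasIndep G p)
HasIndep? G = Clique? (λ u v → ¬? (Adj? G u v))

VArrow2? : ∀ {n} (G : Graph n) r → Dec (VArrow2 G r)
VArrow2? G r =
  ∀-fun? Fin-searchable
         (λ c≗c′ (u , v , uv , same) →
            u , v , uv , trans (sym (c≗c′ u)) (trans same (c≗c′ v)))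
         (λ c → any? λ u → any? λ v → Adj? G u v ×-dec (c u ≟ c v))

Adj-resp : ∀ {n} {G H : Graph n} → G ≈ᴳ H → ∀ u v → Adj G u v → Adj H u v
Adj-resp G≈H u v uv = trans (sym (adj-≡ G≈H u v)) uv

HasClique-resp : ∀ {n} {G H : Graph n} → G ≈ᴳ H → ∀ {p} → HasClique G p → HasClique H p
HasClique-resp G≈H = Clique-map id id (Adj-resp G≈H)

HasIndep-resp : ∀ {n} {G H : Graph n} → G ≈ᴳ H → ∀ {p} → HasIndep G p → HasIndep H p
HasIndep-resp G≈H = Clique-map id id (λ u v ¬uv → ¬uv ∘ Adj-resp (≈ᴳ-sym G≈H) u v)

VArrow2-resp : ∀ {n} {G H : Graph n} → G ≈ᴳ H → ∀ {r} → VArrow2 G r → VArrow2 H r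
VArrow2-resp G≈H arrows c with arrows c
... | u , v , uv , same = u , v , Adj-resp G≈H u v uv , same

-- Adding a universal vertex

cone-adj : ∀ {n} → Graph n → Fin (suc n) → Fin (suc n) → Bool
cone-adj G zero    zero    = false
cone-adj G zero    (suc _) = true
cone-adj G (suc _) zero    = true
cone-adj G (suc u) (suc v) = adj G u v

cone : ∀ {n} → Graph n → Graph (suc n)
cone G = record { adj = cone-adj G ; sym = symmetric ; irrefl = irreflexive }
  where
  symmetric : ∀ u v → cone-adj G u v ≡ cone-adj G v u
  symmetric zero    zero    = refl
  symmetric zero    (suc v) = refl
  symmetric (suc u) zero    = refl
  symmetric (suc u) (suc v) = Graph.sym G u v

  irreflexive : ∀ v → cone-adj G v v ≢ true
  irreflexive zero    ()
  irreflexive (suc v) = Graph.irrefl G v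

-- Either the apex shares its colour with another vertex, or G is coloured by the r other colours.
cone-VArrow2 : ∀ {n r} (G : Graph n) → VArrow2 G r → VArrow2 (cone G) (suc r)
cone-VArrow2 G arrows c with any? (λ w → c zero ≟ c (suc w))
... | yes (w , same) = zero , suc w , refl , same
... | no differ =
  let u , v , uv , same = arrows (λ w → punchOut (differs w))
  in  suc u , suc v , uv , punchOut-injective (differs u) (differs v) same
  where
  differs : ∀ w → c zero ≢ c (suc w)
  differs w same = differ (w , same)

∃-punchIn-avoiding : ∀ {p m} (f : Fin (suc p) → Fin m) → Injective _≡_ _≡_ f →
                     ∀ b → ∃ λ i → ∀ j → f (punchIn i j) ≢ b
∃-punchIn-avoiding f inj b with any? (λ i → f i ≟ b)
... | yes (i , fi≡b) = i , λ j fj≡b → punchInᵢ≢i i j (inj (trans fj≡b (sym fi≡b)))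
... | no  misses     = zero , λ j fj≡b → misses (punchIn zero j , fj≡b)

-- A clique of the cone, with its apex (if any) removed, is a clique of G.
cone-¬HasClique : ∀ {n s} (G : Graph n) → ¬ HasClique G s → ¬ HasClique (cone G) (suc s)
cone-¬HasClique {n} {s} G no-clique (f , inj , adjacent) =
  no-clique (g , g-injective , g-adjacent)
  where
  i = proj₁ (∃-punchIn-avoiding f inj zero)

  apex≢ : ∀ j → zero ≢ f (punchIn i j)
  apex≢ j = proj₂ (∃-punchIn-avoiding f inj zero) j ∘ sym

  g : Fin s → Fin n
  g j = punchOut (apex≢ j)

  suc-g : ∀ j → suc (g j) ≡ f (punchIn i j)
  suc-g j = punchIn-punchOut (apex≢ j)

  g-injective : Injective _≡_ _≡_ g
  g-injective {x} {y} gx≡gy =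
    punchIn-injective i x y (inj (trans (sym (suc-g x)) (trans (cong suc gx≡gy) (suc-g y))))

  g-adjacent : ∀ x y → x ≢ y → Adj G (g x) (g y)
  g-adjacent x y x≢y = subst₂ (Adj (cone G)) (sym (suc-g x)) (sym (suc-g y))
                              (adjacent _ _ (x≢y ∘ punchIn-injective i x y))

cone^ : ∀ {n} a → Graph n → Graph (a + n)
cone^ zero    G = G
cone^ (suc a) G = cone (cone^ a G)

cone^-VArrow2 : ∀ {n r} a (G : Graph n) → VArrow2 G r → VArrow2 (cone^ a G) (a + r)
cone^-VArrow2 zero    G arrows = arrows
cone^-VArrow2 (suc a) G arrows = cone-VArrow2 (cone^ a G) (cone^-VArrow2 a G arrows)

cone^-¬HasClique : ∀ {n s} a (G : Graph n) → ¬ HasClique G s →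
                   ¬ HasClique (cone^ a G) (a + s)
cone^-¬HasClique zero    G no-clique = no-clique
cone^-¬HasClique (suc a) G no-clique = cone-¬HasClique (cone^ a G) (cone^-¬HasClique a G no-clique)

-- Graphs without independent triples

indicator : ∀ {X : Set} → Dec X → Fin 2
indicator (yes _) = suc zero
indicator (no _)  = zero

indicator-reflects : ∀ {X Y : Set} (x? : Dec X) (y? : Dec Y) →
                     indicator x? ≡ indicator y? → Y → X
indicator-reflects (yes x) _       _  _ = x
indicator-reflects (no _)  (yes _) () _
indicator-reflects (no _)  (no ¬y) _  y = ⊥-elim (¬y y)

-- Pigeonhole on (colour of v, whether some w < v has v's colour) gives u < v agreeing on both;
-- as u witnesses this for v, some w does for u, and w, u, v share a colour, so are independent.
¬HasIndep3⇒VArrow2 : ∀ {n t} (G : Graph n) → t * 2 < n → ¬ HasIndep G 3 → VArrow2 G t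
¬HasIndep3⇒VArrow2 {n} {t} G t*2<n no-indep c
  with any? (λ u → any? λ v → Adj? G u v ×-dec (c u ≟ c v))
... | yes edge = edge
... | no no-edge =
  let u , v , u<v , same-label = pigeonhole t*2<n label
      cu≡cv , same-bit = combine-injective (c u) _ (c v) _ same-label
      w , w<u , cw≡cu = indicator-reflects (HasSmallerTwin? u) (HasSmallerTwin? v) same-bit
                                           (u , u<v , cu≡cv)
  in  ⊥-elim (no-indep (Clique-map {R = SameColour} id id nonadjacent
        (Clique-triple {R = SameColour} (λ (x≢x , _) → x≢x refl) SameColour-sym
          (<ᶠ⇒≢ w<u , cw≡cu) (<ᶠ⇒≢ (<ᶠ-trans w<u u<v) , trans cw≡cu cu≡cv) (<ᶠ⇒≢ u<v , cu≡cv))))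
  where
  SameColour : Rel (Fin n) 0ℓ
  SameColour x y = x ≢ y × c x ≡ c y

  SameColour-sym : Symmetric SameColour
  SameColour-sym (x≢y , same) = x≢y ∘ sym , sym same

  nonadjacent : ∀ x y → SameColour x y → ¬ Adj G x y
  nonadjacent x y (_ , same) xy = no-edge (x , y , xy , same)

  HasSmallerTwin : Pred (Fin n) 0ℓ
  HasSmallerTwin v = ∃ λ w → w <ᶠ v × c w ≡ c v

  HasSmallerTwin? : Decidable HasSmallerTwin
  HasSmallerTwin? v = any? λ w → (w <ᶠ? v) ×-dec (c w ≟ c v)

  label : Fin n → Fin (t * 2)
  label v = combine (c v) (indicator (HasSmallerTwin? v))

RamseyGraph : ℕ → ∀ {n} → Graph n → Set
RamseyGraph p H = ¬ HasClique H p × ¬ HasIndep H 3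

RamseyGraph? : ∀ p n → Dec (Σ (Graph n) (RamseyGraph p))
RamseyGraph? p n =
  Graph-search (λ G≈H (no-clique , no-indep) →
                  no-clique ∘ HasClique-resp (≈ᴳ-sym G≈H) , no-indep ∘ HasIndep-resp (≈ᴳ-sym G≈H))
               (λ H → ¬? (HasClique? H p) ×-dec ¬? (HasIndep? H 3))

induced : ∀ {n N} → Graph N → n ≤ N → Graph n
induced G n≤N = record
  { adj    = λ u v → adj G (inject≤ u n≤N) (inject≤ v n≤N)
  ; sym    = λ u v → Graph.sym G _ _
  ; irrefl = λ v → Graph.irrefl G _
  }

Clique-inject≤ : ∀ {n N p} {S : Rel (Fin N) 0ℓ} (n≤N : n ≤ N) →
                 Clique (λ u v → S (inject≤ u n≤N) (inject≤ v n≤N)) p → Clique S p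
Clique-inject≤ {S = S} n≤N =
  Clique-map {S = S} (λ u → inject≤ u n≤N) (inject≤-injective _ _ _ _) (λ _ _ → id)

RamseyProp⇒no-RamseyGraph : ∀ p n → RamseyProp p n → ¬ Σ (Graph n) (RamseyGraph p)
RamseyProp⇒no-RamseyGraph p n ramsey (H , no-clique , no-indep) =
  [ no-clique , no-indep ] (ramsey n ℕ.≤-refl H)

no-RamseyGraph⇒RamseyProp : ∀ p n → ¬ Σ (Graph n) (RamseyGraph p) → RamseyProp p n
no-RamseyGraph⇒RamseyProp p n none N n≤N G
  with HasClique? (induced G n≤N) p | HasIndep? (induced G n≤N) 3
... | yes clique | _         = inj₁ (Clique-inject≤ {S = Adj G} n≤N clique)
... | no _       | yes indep = inj₂ (Clique-inject≤ {S = λ u v → ¬ Adj G u v} n≤N indep)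
... | no ¬clique | no ¬indep = ⊥-elim (none (induced G n≤N , ¬clique , ¬indep))

RamseyProp? : ∀ p n → Dec (RamseyProp p n)
RamseyProp? p n = map′ (no-RamseyGraph⇒RamseyProp p n) (RamseyProp⇒no-RamseyGraph p n)
                       (¬? (RamseyGraph? p n))

<R⇒RamseyGraph : ∀ p h → (∀ R → IsRamsey3 p R → h < R) → Σ (Graph h) (RamseyGraph p)
<R⇒RamseyGraph p h h<R with RamseyGraph? p h
... | yes H   = H
... | no none =
  let ramsey = no-RamseyGraph⇒RamseyProp p h none
      R , R-least = least (RamseyProp? p) ramsey
  in  ⊥-elim (ℕ.<⇒≱ (h<R R R-least) (proj₂ R-least h ramsey))

FvWitness? : ∀ r q N → Dec (FvWitness r q N)
FvWitness? r q N =
  Graph-search (λ G≈H (arrows , no-clique) →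
                  VArrow2-resp G≈H arrows , no-clique ∘ HasClique-resp (≈ᴳ-sym G≈H))
               (λ G → VArrow2? G r ×-dec ¬? (HasClique? G q))

FvWitness⇒IsFv≤ : ∀ {r q N} → FvWitness r q N → Σ ℕ λ F → IsFv r q F × F ≤ N
FvWitness⇒IsFv≤ {r} {q} witness =
  let F , F-least = least (FvWitness? r q) witness
  in  F , F-least , proj₂ F-least _ witness

cone^-FvWitness : ∀ {h t p} (H : Graph h) → VArrow2 H t → ¬ HasClique H p →
                  ∀ a → FvWitness (a + t) (a + p) (a + h)
cone^-FvWitness H arrows no-clique a =
  cone^ a H , cone^-VArrow2 a H arrows , cone^-¬HasClique a H no-clique

theorem2p1 : (m k : ℕ) → 1 ≤ m → 1 ≤ k →
    (∀ R → IsRamsey3 (m ∸ k) R → 2 * m ∸ 1 < R) →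
    k + 3 ≤ m →
    (r : ℕ) → m ∸ 1 ≤ r →
    Σ ℕ λ F → IsFv r (r ∸ k + 1) F × F ≤ r + m
theorem2p1 zero    k ()
theorem2p1 (suc m) k _ _ h<R k+3≤m r m≤r =
  let H , no-clique , no-indep = <R⇒RamseyGraph p h h<R
      witness = cone^-FvWitness H (¬HasIndep3⇒VArrow2 H m*2<h no-indep) no-clique a
      F , F-is-Fv , F≤ = FvWitness⇒IsFv≤ (subst₂ (λ r′ q → FvWitness r′ q (a + h))
                                                 colours clique-bound witness)
  in  F , F-is-Fv , ℕ.≤-trans F≤ (ℕ.≤-reflexive vertices)
  where
  open ≡-Reasoning
  p = suc m ∸ k
  h = 2 * suc m ∸ 1
  a = r ∸ m

  k≤m : k ≤ m
  k≤m = ℕ.m<1+n⇒m≤n (ℕ.<-≤-trans (ℕ.m<m+n k (z<s {2})) k+3≤m)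

  m*2<h : m * 2 < h
  m*2<h = ℕ.≤-reflexive (trans (cong suc (ℕ.*-comm m 2)) (sym (ℕ.+-suc m (m + 0))))

  colours : a + m ≡ r
  colours = ℕ.m∸n+n≡m m≤r

  clique-bound : a + p ≡ r ∸ k + 1
  clique-bound = begin
    a + (suc m ∸ k)   ≡⟨ cong (a +_) (ℕ.+-∸-assoc 1 k≤m) ⟩
    a + suc (m ∸ k)   ≡⟨ ℕ.+-suc a (m ∸ k) ⟩
    suc (a + (m ∸ k)) ≡⟨ cong suc (ℕ.+-∸-assoc a k≤m) ⟨
    suc (a + m ∸ k)   ≡⟨ cong (λ x → suc (x ∸ k)) colours ⟩
    suc (r ∸ k)       ≡⟨ ℕ.+-comm 1 (r ∸ k) ⟩
    r ∸ k + 1         ∎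

  vertices : a + h ≡ r + suc m
  vertices = begin
    a + h                 ≡⟨⟩
    a + (m + suc (m + 0)) ≡⟨ ℕ.+-assoc a m _ ⟨
    a + m + suc (m + 0)   ≡⟨ cong₂ _+_ colours (cong suc (ℕ.+-identityʳ m)) ⟩
    r + suc m             ∎
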